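{- Let $G$ be a digraph, $s,t\in V(G)$, $k\ge 0$ an integer, and $d(w):=\operatorname{dist}(w,t)$ for $w\in V(G)$. Let $P=(s=v_0,v_1,\dots,v_p=v)$ be a path in $G$ of length $p\le d(s)-d(v)+k$ such that $v$ is a distance separator of $P$. Then for every $i\in\{0,\dots,p-2k\}$ there is $j\in\{0,\dots,2k\}$ such that $v_{i+j}$ is a distance separator of $P$.
   Context: A path is a sequence of pairwise distinct vertices with consecutive vertices joined by arcs; $\operatorname{dist}(w,t)$ is the length of a shortest $w$-$t$ path. For a path $P=(v_0,\dots,v_p)$, the vertex $v_i$ is a distance separator of $P$ if $d(v_i)<d(v_j)$ for all $j<i$ and $d(v_i)>d(v_j)$ for all $j>i$. -}

module Defs where

open import Data.Nat using (ℕ; zero; suc; _+_; _≤_; _<_)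
open import Data.Fin using (Fin)
open import Data.Product using (Σ; _×_; ∃)
open import Relation.Binary.PropositionalEquality using (_≡_)
open import Relation.Nullary using (¬_)

data ℕ∞ : Set where
  fin : ℕ → ℕ∞
  ∞   : ℕ∞

_+∞_ : ℕ∞ → ℕ → ℕ∞
fin m +∞ k = fin (m + k)
∞     +∞ k = ∞

data _≤∞_ : ℕ∞ → ℕ∞ → Set where
  fin≤fin : ∀ {m n} → m ≤ n → fin m ≤∞ fin n
  _≤∞∞    : ∀ x → x ≤∞ ∞

data _<∞_ : ℕ∞ → ℕ∞ → Set where
  fin<fin : ∀ {m n} → m < n → fin m <∞ fin n
  fin<∞   : ∀ {m} → fin m <∞ ∞

-- A path of length p is a vertex sequence v 0, …, v p (entries beyond p
-- are irrelevant) with pairwise distinct vertices and consecutive vertices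
-- joined by arcs.
IsPath : ∀ {n} (E : Fin n → Fin n → Set) (p : ℕ) (v : ℕ → Fin n) → Set
IsPath E p v =
  (∀ i → i < p → E (v i) (v (suc i))) ×
  (∀ i j → i ≤ p → j ≤ p → v i ≡ v j → i ≡ j)

HasPath : ∀ {n} (E : Fin n → Fin n → Set) (w t : Fin n) (m : ℕ) → Set
HasPath {n} E w t m = Σ (ℕ → Fin n) λ v → IsPath E m v × v 0 ≡ w × v m ≡ t

IsDist : ∀ {n} (E : Fin n → Fin n → Set) (w t : Fin n) → ℕ∞ → Set
IsDist E w t (fin m) = HasPath E w t m × (∀ m′ → HasPath E w t m′ → m ≤ m′)
IsDist E w t ∞       = ∀ m → ¬ HasPath E w t m

DistSep : ∀ {n} (d : Fin n → ℕ∞) (p : ℕ) (v : ℕ → Fin n) (i : ℕ) → Set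
DistSep d p v i =
  (∀ j → j < i → d (v i) <∞ d (v j)) ×
  (∀ j → i < j → j ≤ p → d (v j) <∞ d (v i))

{-# OPTIONS --safe #-}
module Submission where

open import Defs
open import Data.Nat
open import Data.Nat.Properties
open import Data.Nat.Solver using (module +-*-Solver)
open import Data.Fin using (Fin)
import Data.Fin as Fin
open import Data.Product using (Σ; ∃; _×_; _,_; proj₁)
open import Data.Sum using (_⊎_; inj₁; inj₂)
open import Data.Empty using (⊥-elim)
open import Function using (_∘_; case_of_)
open import Relation.Nullary using (¬_; yes; no)
open import Relation.Binary.PropositionalEquality

-- Along the path d drops by at most one per arc.  With m(y) the minimum of d over
-- v₀,…,v_y and M(y) its maximum over v_y,…,v_p, both m(y) + y and M(y) + y are
-- nondecreasing, and each grows by at most k in total because d(v_p) + p ≤ d(s) + k.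
-- The first one strictly increases at every v_y that is not strictly below all earlier
-- vertices, the second at every v_y that is not strictly above all later ones, so
-- their sum strictly increases at every non-separator; it cannot do so 2k+1 times
-- in a row.

stepwise-mono : ∀ (f : ℕ → ℕ) {p} → (∀ y → y < p → f y ≤ f (suc y)) →
                ∀ {a b} → a ≤ b → b ≤ p → f a ≤ f b
stepwise-mono f step {b = zero}  z≤n  _ = ≤-refl
stepwise-mono f step {b = suc b} a≤1+b 1+b≤p with m≤n⇒m<n∨m≡n a≤1+b
... | inj₂ refl      = ≤-refl
... | inj₁ (s≤s a≤b) =
  ≤-trans (stepwise-mono f step a≤b (≤-trans (n≤1+n b) 1+b≤p)) (step b 1+b≤p)

bounded-drift : ∀ (f : ℕ → ℕ) {p k} → (∀ y → y < p → f y ≤ f (suc y)) →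
                f p ≤ f 0 + k → ∀ {a b} → a ≤ b → b ≤ p → f b ≤ f a + k
bounded-drift f {p} {k} step total {a} {b} a≤b b≤p = begin
  f b     ≤⟨ stepwise-mono f step b≤p ≤-refl ⟩
  f p     ≤⟨ total ⟩
  f 0 + k ≤⟨ +-monoˡ-≤ k (stepwise-mono f step z≤n (≤-trans a≤b b≤p)) ⟩
  f a + k ∎
  where open ≤-Reasoning

witness-or-growth : ∀ (f : ℕ → ℕ) (Q : ℕ → Set) {N} →
                    (∀ y → y < N → Q y ⊎ f y < f (suc y)) →
                    ∀ i L → i + L ≤ N →
                    (Σ ℕ λ j → j < L × Q (i + j)) ⊎ f i + L ≤ f (i + L)
witness-or-growth f Q step i zero _ rewrite +-identityʳ i = inj₂ (≤-reflexive (+-identityʳ (f i)))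
witness-or-growth f Q step i (suc L) i+1+L≤N
  rewrite +-suc i L | +-suc (f i) L
  with witness-or-growth f Q step i L (<⇒≤ i+1+L≤N)
... | inj₁ (j , j<L , Qj) = inj₁ (j , m<n⇒m<1+n j<L , Qj)
... | inj₂ growth with step (i + L) i+1+L≤N
...   | inj₁ Q[i+L] = inj₁ (L , ≤-refl , Q[i+L])
...   | inj₂ f↑     = inj₂ (≤-trans (s≤s growth) f↑)

prefixMin : (ℕ → ℕ) → ℕ → ℕ
prefixMin f zero    = f 0
prefixMin f (suc y) = prefixMin f y ⊓ f (suc y)

prefixMin≤ : ∀ f {j} y → j ≤ y → prefixMin f y ≤ f j
prefixMin≤ f zero    z≤n = ≤-refl
prefixMin≤ f (suc y) j≤1+y with m≤n⇒m<n∨m≡n j≤1+y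
... | inj₂ refl      = m⊓n≤n (prefixMin f y) (f (suc y))
... | inj₁ (s≤s j≤y) = ≤-trans (m⊓n≤m (prefixMin f y) (f (suc y))) (prefixMin≤ f y j≤y)

rangeMax : (ℕ → ℕ) → ℕ → ℕ → ℕ
rangeMax f a zero    = f a
rangeMax f a (suc l) = f a ⊔ rangeMax f (suc a) l

≤rangeMax : ∀ f a l {j} → a ≤ j → j ≤ a + l → f j ≤ rangeMax f a l
≤rangeMax f a zero a≤j j≤a+0
  rewrite ≤-antisym a≤j (≤-trans j≤a+0 (≤-reflexive (+-identityʳ a))) = ≤-refl
≤rangeMax f a (suc l) a≤j j≤a+1+l with m≤n⇒m<n∨m≡n a≤j
... | inj₂ refl = m≤m⊔n (f a) (rangeMax f (suc a) l)
... | inj₁ a<j  = ≤-trans (≤rangeMax f (suc a) l a<j (≤-trans j≤a+1+l (≤-reflexive (+-suc a l))))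
                          (m≤n⊔m (f a) (rangeMax f (suc a) l))

module SeparatorWindow (D : ℕ → ℕ) (p k : ℕ)
  (descent≤1 : ∀ y → y < p → D y ≤ suc (D (suc y)))
  (budget : D p + p ≤ D 0 + k) where

  IsStrictPrefixMin IsStrictSuffixMax IsSeparator : ℕ → Set
  IsStrictPrefixMin y = ∀ j → j < y → D y < D j
  IsStrictSuffixMax y = ∀ j → y < j → j ≤ p → D j < D y
  IsSeparator y = IsStrictPrefixMin y × IsStrictSuffixMax y

  suffixMax : ℕ → ℕ
  suffixMax y = rangeMax D y (p ∸ y)

  suffixMax-step : ∀ y → y < p → suffixMax y ≡ D y ⊔ suffixMax (suc y)
  suffixMax-step y y<p rewrite +-∸-assoc 1 y<p = refl

  ≤suffixMax : ∀ {y j} → y ≤ j → j ≤ p → D j ≤ suffixMax y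
  ≤suffixMax y≤j j≤p =
    ≤rangeMax D _ _ y≤j (≤-trans j≤p (≤-reflexive (sym (m+[n∸m]≡n (≤-trans y≤j j≤p)))))

  lower upper : ℕ → ℕ
  lower y = prefixMin D y + y
  upper y = suffixMax y + y

  lower-mono : ∀ y → y < p → lower y ≤ lower (suc y)
  lower-mono y y<p = begin
    prefixMin D y + y
      ≤⟨ +-monoˡ-≤ y (⊓-glb (n≤1+n _) (≤-trans (prefixMin≤ D y ≤-refl) (descent≤1 y y<p))) ⟩
    suc (prefixMin D y ⊓ D (suc y)) + y
      ≡⟨ sym (+-suc _ y) ⟩
    prefixMin D y ⊓ D (suc y) + suc y ∎
    where open ≤-Reasoning

  lower-step : ∀ y → IsStrictPrefixMin (suc y) ⊎ lower y < lower (suc y)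
  lower-step y with D (suc y) <? prefixMin D y
  ... | yes below = inj₁ λ j j<1+y → <-≤-trans below (prefixMin≤ D y (s≤s⁻¹ j<1+y))
  ... | no ¬below rewrite m≤n⇒m⊓n≡m (≮⇒≥ ¬below) = inj₂ (≤-reflexive (sym (+-suc _ y)))

  upper-mono : ∀ y → y < p → upper y ≤ upper (suc y)
  upper-mono y y<p rewrite suffixMax-step y y<p = begin
    D y ⊔ suffixMax (suc y) + y
      ≤⟨ +-monoˡ-≤ y (⊔-lub (≤-trans (descent≤1 y y<p) (s≤s (≤suffixMax ≤-refl y<p))) (n≤1+n _)) ⟩
    suc (suffixMax (suc y)) + y
      ≡⟨ sym (+-suc _ y) ⟩
    suffixMax (suc y) + suc y ∎
    where open ≤-Reasoning

  upper-step : ∀ y → y < p → IsStrictSuffixMax y ⊎ upper y < upper (suc y)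
  upper-step y y<p rewrite suffixMax-step y y<p with suffixMax (suc y) <? D y
  ... | yes above = inj₁ λ j y<j j≤p → ≤-<-trans (≤suffixMax y<j j≤p) above
  ... | no ¬above rewrite m≤n⇒m⊔n≡n (≮⇒≥ ¬above) = inj₂ (≤-reflexive (sym (+-suc _ y)))

  lower-drift : ∀ {a b} → a ≤ b → b ≤ p → lower b ≤ lower a + k
  lower-drift = bounded-drift lower lower-mono (begin
    prefixMin D p + p ≤⟨ +-monoˡ-≤ p (prefixMin≤ D p ≤-refl) ⟩
    D p + p           ≤⟨ budget ⟩
    D 0 + k           ≡⟨ cong (_+ k) (sym (+-identityʳ (D 0))) ⟩
    lower 0 + k       ∎)
    where open ≤-Reasoning

  upper-drift : ∀ {a b} → a ≤ b → b ≤ p → upper b ≤ upper a + k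
  upper-drift = bounded-drift upper upper-mono (begin
    suffixMax p + p   ≡⟨ cong (λ l → rangeMax D p l + p) (n∸n≡0 p) ⟩
    D p + p           ≤⟨ budget ⟩
    D 0 + k           ≤⟨ +-monoˡ-≤ k (≤-trans (≤suffixMax z≤n z≤n) (m≤m+n _ 0)) ⟩
    upper 0 + k       ∎)
    where open ≤-Reasoning

  -- IsStrictPrefixMin y is witnessed by the step of lower from y - 1 to y, whereas
  -- IsStrictSuffixMax y is witnessed by the step of upper from y to y + 1.
  potential : ℕ → ℕ
  potential y = lower (pred y) + upper y

  potential-step : ∀ y → y < p → IsSeparator y ⊎ potential y < potential (suc y)
  potential-step zero 0<p with upper-step 0 0<p
  ... | inj₁ right = inj₁ ((λ _ ()) , right)
  ... | inj₂ up↑   = inj₂ (+-monoʳ-< (lower 0) up↑)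
  potential-step (suc y) 1+y<p with lower-step y | upper-step (suc y) 1+y<p
  ... | inj₁ left | inj₁ right = inj₁ (left , right)
  ... | inj₂ lo↑  | _          = inj₂ (+-mono-<-≤ lo↑ (upper-mono (suc y) 1+y<p))
  ... | _         | inj₂ up↑   = inj₂ (+-mono-≤-< (lower-mono y (<⇒≤ 1+y<p)) up↑)

  potential-drift : ∀ {a b} → a ≤ b → b ≤ p → potential b ≤ potential a + 2 * k
  potential-drift {a} {b} a≤b b≤p = begin
    lower (pred b) + upper b                 ≤⟨ +-mono-≤ (lower-drift (pred-mono-≤ a≤b) (≤-trans pred[n]≤n b≤p))
                                                         (upper-drift a≤b b≤p) ⟩
    (lower (pred a) + k) + (upper a + k)     ≡⟨ solve 3 (λ x y z → (x :+ z) :+ (y :+ z) := (x :+ y) :+ con 2 :* z)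
                                                        refl (lower (pred a)) (upper a) k ⟩
    lower (pred a) + upper a + 2 * k         ∎
    where open ≤-Reasoning
          open +-*-Solver

  separator-in-window : ∀ i → i + 2 * k < p → Σ ℕ λ j → j ≤ 2 * k × IsSeparator (i + j)
  separator-in-window i i+2k<p =
    case witness-or-growth potential IsSeparator potential-step i (suc (2 * k)) window≤p of λ where
      (inj₁ (j , j≤2k , sep)) → j , s≤s⁻¹ j≤2k , sep
      (inj₂ growth) → ⊥-elim (1+n≰n (+-cancelˡ-≤ (potential i) _ _
                         (≤-trans growth (potential-drift (m≤m+n i _) window≤p))))
    where
    window≤p : i + suc (2 * k) ≤ p
    window≤p = ≤-trans (≤-reflexive (+-suc i (2 * k))) i+2k<p

infixr 5 _◂_
_◂_ : ∀ {n} → Fin n → (ℕ → Fin n) → ℕ → Fin n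
(u ◂ q) zero    = u
(u ◂ q) (suc i) = q i

module _ {n} (E : Fin n → Fin n → Set) where

  ◂-isPath : ∀ {m u q} → IsPath E m q → E u (q 0) → ¬ (∃ λ j → j < suc m × q j ≡ u) →
             IsPath E (suc m) (u ◂ q)
  ◂-isPath {m} {u} {q} (arcs , distinct) u→q₀ u∉q = arcs′ , distinct′
    where
    arcs′ : ∀ i → i < suc m → E ((u ◂ q) i) ((u ◂ q) (suc i))
    arcs′ zero    _         = u→q₀
    arcs′ (suc i) (s≤s i<m) = arcs i i<m
    distinct′ : ∀ i j → i ≤ suc m → j ≤ suc m → (u ◂ q) i ≡ (u ◂ q) j → i ≡ j
    distinct′ zero    zero    _         _         _     = refl
    distinct′ zero    (suc j) _         (s≤s j≤m) u≡qj  = ⊥-elim (u∉q (j , s≤s j≤m , sym u≡qj))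
    distinct′ (suc i) zero    (s≤s i≤m) _         qi≡u  = ⊥-elim (u∉q (i , s≤s i≤m , qi≡u))
    distinct′ (suc i) (suc j) (s≤s i≤m) (s≤s j≤m) qi≡qj = cong suc (distinct i j i≤m j≤m qi≡qj)

  drop-isPath : ∀ j {r q} → IsPath E (j + r) q → IsPath E r (λ i → q (j + i))
  drop-isPath j {r} {q} (arcs , distinct) = arcs′ , distinct′
    where
    arcs′ : ∀ i → i < r → E (q (j + i)) (q (j + suc i))
    arcs′ i i<r = subst (λ x → E (q (j + i)) (q x)) (sym (+-suc j i)) (arcs (j + i) (+-monoʳ-< j i<r))
    distinct′ : ∀ a b → a ≤ r → b ≤ r → q (j + a) ≡ q (j + b) → a ≡ b
    distinct′ a b a≤r b≤r qa≡qb =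
      +-cancelˡ-≡ j a b (distinct (j + a) (j + b) (+-monoʳ-≤ j a≤r) (+-monoʳ-≤ j b≤r) qa≡qb)

  -- If u already lies on the w-t path, its tail from u is a shorter u-t path.
  arc-hasPath : ∀ {u w t m} → E u w → HasPath E w t m → ∃ λ m′ → m′ ≤ suc m × HasPath E u t m′
  arc-hasPath {u} {m = m} u→w (q , isPath , refl , qm≡t) with anyUpTo? (λ j → q j Fin.≟ u) (suc m)
  ... | no u∉q = suc m , ≤-refl , u ◂ q , ◂-isPath isPath u→w u∉q , refl , qm≡t
  ... | yes (j , j<1+m , refl) with m≤n⇒∃[o]m+o≡n (s≤s⁻¹ j<1+m)
  ...   | r , refl = r , ≤-trans (m≤n+m r j) (n≤1+n _) ,
                     (λ i → q (j + i)) , drop-isPath j isPath , cong q (+-identityʳ j) , qm≡t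

  arc-dist : ∀ {t} {d : Fin n → ℕ∞} → (∀ w → IsDist E w t (d w)) →
             ∀ {u w} → E u w → d u ≤∞ (d w +∞ 1)
  arc-dist {d = d} isDist {u} {w} u→w with d w | isDist w
  ... | ∞     | _          = d u ≤∞∞
  ... | fin m | (w⇝t , _) with arc-hasPath u→w w⇝t
  ...   | m′ , m′≤1+m , u⇝t with d u | isDist u
  ...     | fin a | (_ , shortest) =
    fin≤fin (≤-trans (shortest m′ u⇝t) (≤-trans m′≤1+m (≤-reflexive (+-comm 1 m))))
  ...     | ∞     | unreachable    = ⊥-elim (unreachable m′ u⇝t)

-- The value at ∞ is junk: toℕ is only meaningful on Finite arguments.
toℕ : ℕ∞ → ℕ
toℕ (fin m) = m
toℕ ∞       = 0

Finite : ℕ∞ → Set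
Finite x = x ≡ fin (toℕ x)

<∞-finite : ∀ {x y} → x <∞ y → Finite x
<∞-finite (fin<fin _) = refl
<∞-finite fin<∞       = refl

≤∞+1-finite : ∀ {x y} → x ≤∞ (y +∞ 1) → Finite y → Finite x
≤∞+1-finite {y = fin _} (fin≤fin _) _ = refl

≤∞+1⇒toℕ≤ : ∀ {x y} → Finite y → x ≤∞ (y +∞ 1) → toℕ x ≤ suc (toℕ y)
≤∞+1⇒toℕ≤ {y = fin b} _ (fin≤fin a≤b+1) = ≤-trans a≤b+1 (≤-reflexive (+-comm b 1))

+∞-≤∞⇒toℕ≤ : ∀ {x y a b} → Finite y → (x +∞ a) ≤∞ (y +∞ b) → toℕ x + a ≤ toℕ y + b
+∞-≤∞⇒toℕ≤ {fin _} {fin _} _ (fin≤fin le) = le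
+∞-≤∞⇒toℕ≤ {∞}     {fin _} _ ()
+∞-≤∞⇒toℕ≤ {y = ∞} ()

toℕ-<⇒<∞ : ∀ {x y} → Finite x → Finite y → toℕ x < toℕ y → x <∞ y
toℕ-<⇒<∞ {fin _} {fin _} _ _ lt = fin<fin lt
toℕ-<⇒<∞ {∞} ()
toℕ-<⇒<∞ {y = ∞} _ ()

finite-below : ∀ (x : ℕ → ℕ∞) p → (∀ i → i < p → x i ≤∞ (x (suc i) +∞ 1)) →
               Finite (x p) → ∀ j → j ≤ p → Finite (x j)
finite-below x zero    _    fin-0 zero z≤n = fin-0
finite-below x (suc p) step fin-p j j≤1+p with m≤n⇒m<n∨m≡n j≤1+p
... | inj₂ refl      = fin-p
... | inj₁ (s≤s j≤p) = finite-below x p (λ i i<p → step i (m<n⇒m<1+n i<p))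
                                      (≤∞+1-finite (step p ≤-refl) fin-p) j j≤p

lemma25 : ∀ {n} (E : Fin n → Fin n → Set) (s t : Fin n) (k : ℕ)
            (d : Fin n → ℕ∞) → (∀ w → IsDist E w t (d w)) →
            (p : ℕ) (v : ℕ → Fin n) → IsPath E p v → v 0 ≡ s →
            (d (v p) +∞ p) ≤∞ (d s +∞ k) →
            DistSep d p v p →
            ∀ i → i + 2 * k ≤ p →
            Σ ℕ λ j → j ≤ 2 * k × DistSep d p v (i + j)
lemma25 E s t k d isDist p v (arcs , _) refl budget sep i i+2k≤p with m≤n⇒m<n∨m≡n i+2k≤p
... | inj₂ i+2k≡p = 2 * k , ≤-refl , subst (DistSep d p v) (sym i+2k≡p) sep
... | inj₁ i+2k<p =
  let (j , j≤2k , separator) = separator-in-window i i+2k<p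
  in  j , j≤2k , toDistSep (≤-trans (+-monoʳ-≤ i j≤2k) i+2k≤p) separator
  where
  arc-descent : ∀ y → y < p → d (v y) ≤∞ (d (v (suc y)) +∞ 1)
  arc-descent y y<p = arc-dist E isDist (arcs y y<p)

  finite : ∀ y → y ≤ p → Finite (d (v y))
  finite = finite-below (d ∘ v) p arc-descent (<∞-finite (proj₁ sep 0 (≤-<-trans z≤n i+2k<p)))

  open SeparatorWindow (toℕ ∘ d ∘ v) p k
         (λ y y<p → ≤∞+1⇒toℕ≤ (finite (suc y) y<p) (arc-descent y y<p))
         (+∞-≤∞⇒toℕ≤ (finite 0 z≤n) budget)

  toDistSep : ∀ {y} → y ≤ p → IsSeparator y → DistSep d p v y
  toDistSep y≤p (left , right) =
    (λ j j<y → toℕ-<⇒<∞ (finite _ y≤p) (finite j (≤-trans (<⇒≤ j<y) y≤p)) (left j j<y)) ,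
    (λ j y<j j≤p → toℕ-<⇒<∞ (finite j j≤p) (finite _ y≤p) (right j y<j j≤p))
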